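{- Let $p$ be an odd prime and let $\bar\Lambda_0=\overline{\mathbb{F}}_p[\epsilon]/\langle\epsilon^p-1\rangle=\overline{\mathbb{F}}_p[y]/\langle y^p\rangle$ with $y=\epsilon-1$. Let $f=\sum_{i=0}^{p-1}a_iy^i\in y\bar\Lambda_0$ (so $a_0=0$), and let $f_y(0)=a_1$ denote the value at $0$ of the derivative of $f$ with respect to $y$. Then \[\mathrm{dlog}(E_0(f))=\bigl(1+f_y(0)^{p-1}y^{p-1}\bigr)\,df,\] where $E_0(f)=\sum_{i=0}^{p-1}f^i/i!$.
   Context: $d:\bar\Lambda_0\to\Omega_{\bar\Lambda_0/\overline{\mathbb{F}}_p}$ is the universal derivation to the module of Kähler differentials, and for a unit $u$, $\mathrm{dlog}(u)=u^{ -1}du$. The truncated exponential $E_0(f)=\sum_{i=0}^{p-1}f^i/i!$ is a unit of $\bar\Lambda_0$ for $f\in y\bar\Lambda_0$. The same statement holds with $\overline{\mathbb{F}}_p$ replaced by $\mathbb{F}_p$. -}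

module Defs where

open import Level using (Level; _⊔_) renaming (suc to lsuc)
open import Data.Nat using (ℕ; zero; suc; _∸_; _<_; _≤_; _!)
open import Data.List using (List; []; _∷_; length; map)
open import Data.Product using (∃; _×_)
open import Relation.Nullary using (¬_)
open import Algebra.Bundles using (CommutativeRing; AbelianGroup)

module Base {c ℓ : Level} (R : CommutativeRing c ℓ) where
  open CommutativeRing R

  fromℕ : ℕ → Carrier
  fromℕ zero    = 0#
  fromℕ (suc n) = 1# + fromℕ n

  powK : Carrier → ℕ → Carrier
  powK x zero    = 1#
  powK x (suc n) = x * powK x n

  eval : List Carrier → Carrier → Carrier
  eval []       x = 0#
  eval (a ∷ as) x = a + x * eval as x

  evalMonic : List Carrier → Carrier → Carrier
  evalMonic cs x = powK x (length cs) + eval cs x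

  record IsAlgClosureOfFp (p : ℕ) : Set (c ⊔ ℓ) where
    field
      1≉0       : ¬ (1# ≈ 0#)
      inv       : Carrier → Carrier
      inv-right : ∀ x → ¬ (x ≈ 0#) → (x * inv x) ≈ 1#
      char-p    : fromℕ p ≈ 0#
      algClosed : ∀ (cs : List Carrier) → 1 ≤ length cs →
                  ∃ λ x → evalMonic cs x ≈ 0#
      algebraic : ∀ (x : Carrier) → ∃ λ (ns : List ℕ) →
                  (1 ≤ length ns) × (evalMonic (map fromℕ ns) x ≈ 0#)

  -- Λ̄₀ = k[y]/⟨y^p⟩ : an element is a coefficient sequence ℕ → k
  -- (coefficient of y^n); two elements are equal iff their
  -- coefficients agree in degrees n < p.
  Λ : Set c
  Λ = ℕ → Carrier

  module Trunc (p : ℕ) where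

    infix 4 _≈Λ_
    _≈Λ_ : Λ → Λ → Set ℓ
    f ≈Λ g = ∀ n → n < p → f n ≈ g n

  constΛ : Carrier → Λ
  constΛ a zero    = a
  constΛ a (suc n) = 0#

  zeroΛ oneΛ yΛ : Λ
  zeroΛ = constΛ 0#
  oneΛ  = constΛ 1#
  yΛ zero          = 0#
  yΛ (suc zero)    = 1#
  yΛ (suc (suc n)) = 0#

  infixl 6 _+Λ_
  infixl 7 _*Λ_

  _+Λ_ : Λ → Λ → Λ
  (f +Λ g) n = f n + g n

  sumBelow : (ℕ → Carrier) → ℕ → Carrier
  sumBelow h zero    = 0#
  sumBelow h (suc n) = sumBelow h n + h n

  _*Λ_ : Λ → Λ → Λ
  (f *Λ g) n = sumBelow (λ i → f i * g (n ∸ i)) (suc n)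

  powΛ : Λ → ℕ → Λ
  powΛ f zero    = oneΛ
  powΛ f (suc n) = f *Λ powΛ f n

  sumBelowΛ : (ℕ → Λ) → ℕ → Λ
  sumBelowΛ F zero    = zeroΛ
  sumBelowΛ F (suc n) = sumBelowΛ F n +Λ F n

  E0 : (inv : Carrier → Carrier) (p : ℕ) → Λ → Λ
  E0 inv p f = sumBelowΛ (λ i → constΛ (inv (fromℕ (i !))) *Λ powΛ f i) p

  module Mod (p : ℕ) where
    open Trunc p

    record ΛModule (m ℓm : Level) : Set (c ⊔ ℓ ⊔ lsuc (m ⊔ ℓm)) where
      field
        abGroup : AbelianGroup m ℓm
      open AbelianGroup abGroup public
        renaming (Carrier to M; _≈_ to _≈M_; _∙_ to _+M_; ε to 0M; _⁻¹ to -M_)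
      infixr 7 _·_
      field
        _·_        : Λ → M → M
        ·-cong     : ∀ {f g x y} → f ≈Λ g → x ≈M y → (f · x) ≈M (g · y)
        ·-distribʳ : ∀ f g x → ((f +Λ g) · x) ≈M ((f · x) +M (g · x))
        ·-distribˡ : ∀ f x y → (f · (x +M y)) ≈M ((f · x) +M (f · y))
        ·-assoc    : ∀ f g x → ((f *Λ g) · x) ≈M (f · (g · x))
        ·-identity : ∀ x → (oneΛ · x) ≈M x

    record Derivation {m ℓm : Level} (Mo : ΛModule m ℓm) : Set (c ⊔ ℓ ⊔ m ⊔ ℓm) where
      open ΛModule Mo
      field
        d        : Λ → M
        d-cong   : ∀ {f g} → f ≈Λ g → d f ≈M d g
        d-+      : ∀ f g → d (f +Λ g) ≈M (d f +M d g)
        leibniz  : ∀ f g → d (f *Λ g) ≈M ((f · d g) +M (g · d f))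
        d-const  : ∀ a → d (constΛ a) ≈M 0M

module Submission where

-- The power rule d(fⁱ) = i fⁱ⁻¹ df turns d E₀(f) into E₁ df, where E₁ = Σ_{i<p−1} fⁱ/i! is
-- E₀(f) without its top term. By Wilson's theorem 1/(p−1)! = −1, so E₁ = E₀(f) + f^{p−1} and
-- u E₁ = 1 + u f^{p−1} for the inverse u of E₀(f). Since f has no constant term, f^{p−1} starts
-- with f_y(0)^{p−1} y^{p−1} and u starts with 1, hence u f^{p−1} = f_y(0)^{p−1} y^{p−1} modulo y^p.

open import Defs
open import Level using (Level)
open import Function using (_∘_)
open import Data.Empty using (⊥-elim)
open import Data.Nat as ℕ using (ℕ; zero; suc; pred; _∸_; _<_; _≤_; s≤s; z<s; s<s; _!; NonZero)
open import Data.Nat.Properties as ℕ using (≤-total; ≤-trans; ≤-reflexive; n<1+n; n≤1+n)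
open import Data.Nat.DivMod using (_%_; _/_; m≡m%n+[m/n]*n; m%n<n)
open import Data.Nat.Divisibility using (_∣_; m%n≡0⇒n∣m; >⇒∤)
open import Data.Nat.Primality using (Prime; ¬prime[0]; euclidsLemma; prime⇒nonZero; prime⇒nonTrivial)
open import Data.Nat.Coprimality using (coprime-Bézout; prime⇒coprime)
open import Data.Nat.GCD using (module Bézout)
open import Data.Nat.Tactic.RingSolver using (solve-∀)
open import Data.List as List using (List; []; _∷_; foldr; length; applyDownFrom)
open import Data.List.Properties using (length-removeAt′)
open import Data.List.Relation.Unary.Any using (here; there; index; _─_)
import Data.List.Relation.Unary.All.Properties as All
open import Data.List.Relation.Unary.Unique.Propositional using (Unique; _∷_)
open import Data.List.Relation.Unary.Unique.Propositional.Properties using (Unique[x∷xs]⇒x∉xs; applyDownFrom⁺₁)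
open import Data.List.Membership.Propositional using (_∈_; _∉_)
open import Data.List.Membership.Propositional.Properties using (∈-applyDownFrom⁺; ∈-applyDownFrom⁻)
open import Data.Product using (∃-syntax; _×_; _,_)
open import Data.Sum using (inj₁; inj₂)
open import Relation.Nullary using (¬_; yes; no; contradiction)
open import Relation.Binary.Definitions using (tri<; tri≈; tri>)
open import Relation.Binary.PropositionalEquality as ≡ using (_≡_; _≢_)
open import Algebra.Bundles using (CommutativeMonoid; CommutativeRing)

module _ {a : Level} {A : Set a} where

  ∈-─⁻ : ∀ {xs : List A} {y z} (y∈xs : y ∈ xs) → z ∈ (xs ─ y∈xs) → z ∈ xs
  ∈-─⁻ (here ≡.refl) z∈ = there z∈
  ∈-─⁻ (there y∈xs) (here ≡.refl) = here ≡.refl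
  ∈-─⁻ (there y∈xs) (there z∈) = there (∈-─⁻ y∈xs z∈)

  ∈-─⁺ : ∀ {xs : List A} {y z} (y∈xs : y ∈ xs) → z ∈ xs → z ≢ y → z ∈ (xs ─ y∈xs)
  ∈-─⁺ (here ≡.refl) (here ≡.refl) z≢y = contradiction ≡.refl z≢y
  ∈-─⁺ (here ≡.refl) (there z∈) z≢y = z∈
  ∈-─⁺ (there y∈xs) (here ≡.refl) z≢y = here ≡.refl
  ∈-─⁺ (there y∈xs) (there z∈) z≢y = there (∈-─⁺ y∈xs z∈ z≢y)

  Unique-─ : ∀ {xs : List A} {y} (y∈xs : y ∈ xs) → Unique xs → Unique (xs ─ y∈xs)
  Unique-─ (here ≡.refl) (_ ∷ xs!) = xs!
  Unique-─ (there y∈xs) (x∉ ∷ xs!) = All.─⁺ y∈xs x∉ ∷ Unique-─ y∈xs xs!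

  ∉-─ : ∀ {xs : List A} {y} (y∈xs : y ∈ xs) → Unique xs → y ∉ (xs ─ y∈xs)
  ∉-─ (here ≡.refl) xs! = Unique[x∷xs]⇒x∉xs xs!
  ∉-─ (there y∈xs) xs! (here ≡.refl) = Unique[x∷xs]⇒x∉xs xs! y∈xs
  ∉-─ (there y∈xs) (_ ∷ xs!) (there y∈) = ∉-─ y∈xs xs! y∈

module Products {c ℓ : Level} (M : CommutativeMonoid c ℓ) where
  open CommutativeMonoid M
  open import Algebra.Properties.CommutativeSemigroup commutativeSemigroup using (x∙yz≈y∙xz)
  open import Relation.Binary.Reasoning.Setoid setoid

  inverse-unique : ∀ {x y z} → x ∙ y ≈ ε → x ∙ z ≈ ε → y ≈ z
  inverse-unique {x} {y} {z} xy≈ε xz≈ε = begin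
    y             ≈⟨ sym (identityʳ y) ⟩
    y ∙ ε         ≈⟨ ∙-congˡ (sym xz≈ε) ⟩
    y ∙ (x ∙ z)   ≈⟨ sym (assoc y x z) ⟩
    (y ∙ x) ∙ z   ≈⟨ ∙-congʳ (trans (comm y x) xy≈ε) ⟩
    ε ∙ z         ≈⟨ identityˡ z ⟩
    z             ∎

  module _ {a : Level} {A : Set a} where

    ∏ : (A → Carrier) → List A → Carrier
    ∏ g = foldr (λ x r → g x ∙ r) ε

    ∏-─ : ∀ (g : A → Carrier) {xs y} (y∈xs : y ∈ xs) → ∏ g xs ≈ g y ∙ ∏ g (xs ─ y∈xs)
    ∏-─ g (here ≡.refl) = refl
    ∏-─ g {x ∷ xs} {y} (there y∈xs) = begin
      g x ∙ ∏ g xs                      ≈⟨ ∙-congˡ (∏-─ g y∈xs) ⟩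
      g x ∙ (g y ∙ ∏ g (xs ─ y∈xs))     ≈⟨ x∙yz≈y∙xz (g x) (g y) _ ⟩
      g y ∙ (g x ∙ ∏ g (xs ─ y∈xs))     ∎

    InjectiveOn : (A → Carrier) → List A → Set _
    InjectiveOn g xs = ∀ {y z} → y ∈ xs → z ∈ xs → g y ≈ g z → y ≡ z

    Paired : (A → Carrier) → List A → Set _
    Paired g xs = ∀ {x} → x ∈ xs → ∃[ y ] y ∈ xs × y ≢ x × g x ∙ g y ≈ ε

    -- The head x is removed together with its partner y; the partner of any other element is
    -- neither x nor y, because inverses are unique and g is injective on xs.
    ∏-paired : ∀ n {g : A → Carrier} {xs} → length xs ≤ n → Unique xs →
               InjectiveOn g xs → Paired g xs → ∏ g xs ≈ ε
    ∏-paired _ {xs = []} _ _ _ _ = refl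
    ∏-paired (suc n) {g} {x ∷ xs} (s≤s |xs|≤n) xs!@(_ ∷ tail!) inj paired
      with paired (here ≡.refl)
    ... | _ , here ≡.refl , y≢x , _ = contradiction ≡.refl y≢x
    ... | y , there y∈xs , _ , xy≈ε = begin
      g x ∙ ∏ g xs              ≈⟨ ∙-congˡ (∏-─ g y∈xs) ⟩
      g x ∙ (g y ∙ ∏ g rest)    ≈⟨ sym (assoc (g x) (g y) _) ⟩
      (g x ∙ g y) ∙ ∏ g rest    ≈⟨ ∙-congʳ xy≈ε ⟩
      ε ∙ ∏ g rest              ≈⟨ identityˡ _ ⟩
      ∏ g rest                  ≈⟨ ∏-paired n |rest|≤n (Unique-─ y∈xs tail!) inj-rest paired-rest ⟩
      ε                         ∎
      where
      rest = xs ─ y∈xs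
      |rest|≤n : length rest ≤ n
      |rest|≤n = ≤-trans (n≤1+n _) (≤-trans (≤-reflexive (≡.sym (length-removeAt′ xs (index y∈xs)))) |xs|≤n)
      inj-rest : InjectiveOn g rest
      inj-rest z∈ w∈ = inj (there (∈-─⁻ y∈xs z∈)) (there (∈-─⁻ y∈xs w∈))
      paired-rest : Paired g rest
      paired-rest {z} z∈rest with paired (there (∈-─⁻ y∈xs z∈rest))
      ... | w , here ≡.refl , _ , zx≈ε =
        contradiction (≡.subst (_∈ rest) (inj (there (∈-─⁻ y∈xs z∈rest)) (there y∈xs)
                         (inverse-unique (trans (comm _ _) zx≈ε) xy≈ε)) z∈rest)
                      (∉-─ y∈xs tail!)
      ... | w , there w∈xs , w≢z , zw≈ε = w , ∈-─⁺ y∈xs w∈xs w≢y , w≢z , zw≈ε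
        where
        w≢y : w ≢ y
        w≢y ≡.refl = Unique[x∷xs]⇒x∉xs xs!
          (≡.subst (_∈ xs) (inj (there (∈-─⁻ y∈xs z∈rest)) (here ≡.refl)
             (inverse-unique (trans (comm _ _) zw≈ε) (trans (comm _ _) xy≈ε))) (∈-─⁻ y∈xs z∈rest))

module RingFacts {c ℓ : Level} (R : CommutativeRing c ℓ) where
  open CommutativeRing R
  open Base R
  open import Algebra.Properties.Ring ring using (-1*x≈-x; -‿involutive; +-identityʳ-unique; +-inverseʳ-unique)
  open import Algebra.Properties.Semiring.Mult semiring using (×-homo-+; ×1-homo-*) renaming (_×_ to _×′_)
  open import Relation.Binary.Reasoning.Setoid setoid
  open Products *-commutativeMonoid using (∏; inverse-unique)
  open import Algebra.Properties.CommutativeSemigroup *-commutativeSemigroup using (x∙yz≈y∙xz)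

  fromℕ≡×1 : ∀ n → fromℕ n ≡ n ×′ 1#
  fromℕ≡×1 zero = ≡.refl
  fromℕ≡×1 (suc n) = ≡.cong (1# +_) (fromℕ≡×1 n)

  fromℕ-homo-+ : ∀ m n → fromℕ (m ℕ.+ n) ≈ fromℕ m + fromℕ n
  fromℕ-homo-+ m n rewrite fromℕ≡×1 (m ℕ.+ n) | fromℕ≡×1 m | fromℕ≡×1 n = ×-homo-+ 1# m n

  fromℕ-homo-* : ∀ m n → fromℕ (m ℕ.* n) ≈ fromℕ m * fromℕ n
  fromℕ-homo-* m n rewrite fromℕ≡×1 (m ℕ.* n) | fromℕ≡×1 m | fromℕ≡×1 n = ×1-homo-* m n

  fromℕ-suc≈0 : ∀ n → fromℕ (suc n) ≈ 0# → fromℕ n ≈ - 1#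
  fromℕ-suc≈0 n = +-inverseʳ-unique 1# (fromℕ n)

  -1*-1≈1 : - 1# * - 1# ≈ 1#
  -1*-1≈1 = trans (-1*x≈-x (- 1#)) (-‿involutive 1#)

  fromℕ[r+1]!≈∏ : ∀ r → fromℕ (suc r !) ≈ ∏ fromℕ (applyDownFrom (2 ℕ.+_) r)
  fromℕ[r+1]!≈∏ zero = +-identityʳ 1#
  fromℕ[r+1]!≈∏ (suc r) = begin
    fromℕ ((2 ℕ.+ r) ℕ.* suc r !)        ≈⟨ fromℕ-homo-* (2 ℕ.+ r) (suc r !) ⟩
    fromℕ (2 ℕ.+ r) * fromℕ (suc r !)    ≈⟨ *-congˡ (fromℕ[r+1]!≈∏ r) ⟩
    fromℕ (2 ℕ.+ r) * ∏ fromℕ (applyDownFrom (2 ℕ.+_) r) ∎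

  module PrimeCharacteristic {p : ℕ} (p-prime : Prime p) (1≉0 : 1# ≉ 0#) (char-p : fromℕ p ≈ 0#) where
    private instance
      p-nonZero : NonZero p
      p-nonZero = prime⇒nonZero p-prime

    1<p : 1 < p
    1<p = ℕ.nonTrivial⇒n>1 p {{prime⇒nonTrivial p-prime}}

    fromℕ-*p : ∀ k → fromℕ (k ℕ.* p) ≈ 0#
    fromℕ-*p k = trans (fromℕ-homo-* k p) (trans (*-congˡ char-p) (zeroʳ _))

    fromℕ-% : ∀ n → fromℕ n ≈ fromℕ (n % p)
    fromℕ-% n = begin
      fromℕ n                                ≡⟨ ≡.cong fromℕ (m≡m%n+[m/n]*n n p) ⟩
      fromℕ (n % p ℕ.+ (n / p) ℕ.* p)        ≈⟨ fromℕ-homo-+ (n % p) _ ⟩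
      fromℕ (n % p) + fromℕ ((n / p) ℕ.* p)  ≈⟨ +-congˡ (fromℕ-*p (n / p)) ⟩
      fromℕ (n % p) + 0#                     ≈⟨ +-identityʳ _ ⟩
      fromℕ (n % p)                          ∎

    fromℕ[pred-p]≈-1 : fromℕ (pred p) ≈ - 1#
    fromℕ[pred-p]≈-1 = fromℕ-suc≈0 (pred p) (≡.subst (λ n → fromℕ n ≈ 0#) (≡.sym (ℕ.suc-pred p)) char-p)

    inverse-mod-p : ∀ n j → fromℕ n * fromℕ j ≈ 1# → ∃[ j′ ] j′ < p × fromℕ n * fromℕ j′ ≈ 1#
    inverse-mod-p n j nj≈1 = j % p , m%n<n j p , trans (*-congˡ (sym (fromℕ-% j))) nj≈1

    fromℕ-invertible : ∀ {n} → 0 < n → n < p → ∃[ j ] j < p × fromℕ n * fromℕ j ≈ 1#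
    fromℕ-invertible {n@(suc _)} _ n<p with coprime-Bézout (prime⇒coprime p-prime n<p)
    ... | Bézout.+- x y 1+yn≡xp = inverse-mod-p n (pred p ℕ.* y) (begin
      fromℕ n * fromℕ (pred p ℕ.* y)        ≈⟨ *-congˡ (fromℕ-homo-* (pred p) y) ⟩
      fromℕ n * (fromℕ (pred p) * fromℕ y)  ≈⟨ *-congˡ (*-congʳ fromℕ[pred-p]≈-1) ⟩
      fromℕ n * (- 1# * fromℕ y)            ≈⟨ x∙yz≈y∙xz (fromℕ n) (- 1#) (fromℕ y) ⟩
      - 1# * (fromℕ n * fromℕ y)            ≈⟨ *-congˡ (trans (*-comm _ _) (sym (fromℕ-homo-* y n))) ⟩
      - 1# * fromℕ (y ℕ.* n)                ≈⟨ *-congˡ yn≈-1 ⟩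
      - 1# * - 1#                           ≈⟨ -1*-1≈1 ⟩
      1#                                    ∎)
      where
      yn≈-1 : fromℕ (y ℕ.* n) ≈ - 1#
      yn≈-1 = fromℕ-suc≈0 (y ℕ.* n) (trans (reflexive (≡.cong fromℕ 1+yn≡xp)) (fromℕ-*p x))
    ... | Bézout.-+ x y 1+xp≡yn = inverse-mod-p n y (begin
      fromℕ n * fromℕ y           ≈⟨ trans (*-comm _ _) (sym (fromℕ-homo-* y n)) ⟩
      fromℕ (y ℕ.* n)             ≡⟨ ≡.cong fromℕ (≡.sym 1+xp≡yn) ⟩
      1# + fromℕ (x ℕ.* p)        ≈⟨ +-congˡ (fromℕ-*p x) ⟩
      1# + 0#                     ≈⟨ +-identityʳ 1# ⟩
      1#                          ∎)

    fromℕ≈0⇒p∣ : ∀ n → fromℕ n ≈ 0# → p ∣ n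
    fromℕ≈0⇒p∣ n n≈0 with n % p in n%p≡ | fromℕ-% n
    ... | zero  | _ = m%n≡0⇒n∣m n p n%p≡
    ... | suc r | n≈r+1 with fromℕ-invertible {suc r} z<s (≡.subst (_< p) n%p≡ (m%n<n n p))
    ...   | j , _ , e = contradiction (begin
      1#                        ≈⟨ sym e ⟩
      fromℕ (suc r) * fromℕ j   ≈⟨ *-congʳ (trans (sym n≈r+1) n≈0) ⟩
      0# * fromℕ j              ≈⟨ zeroˡ _ ⟩
      0#                        ∎) 1≉0

    fromℕ-≤-injective : ∀ {a b} → a ≤ b → b < p → fromℕ a ≈ fromℕ b → a ≡ b
    fromℕ-≤-injective {a} {b} a≤b b<p a≈b with b ℕ.∸ a in b∸a≡ | fromℕ≈0⇒p∣ (b ℕ.∸ a) b∸a≈0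
      where
      b∸a≈0 : fromℕ (b ℕ.∸ a) ≈ 0#
      b∸a≈0 = +-identityʳ-unique (fromℕ a) _ (begin
        fromℕ a + fromℕ (b ℕ.∸ a)   ≈⟨ sym (fromℕ-homo-+ a (b ℕ.∸ a)) ⟩
        fromℕ (a ℕ.+ (b ℕ.∸ a))     ≡⟨ ≡.cong fromℕ (ℕ.m+[n∸m]≡n a≤b) ⟩
        fromℕ b                     ≈⟨ sym a≈b ⟩
        fromℕ a                     ∎)
    ... | zero  | _ = ℕ.≤-antisym a≤b (ℕ.m∸n≡0⇒m≤n b∸a≡)
    ... | suc k | p∣ = contradiction p∣ (>⇒∤ (ℕ.≤-<-trans (≡.subst (_≤ b) b∸a≡ (ℕ.m∸n≤m b a)) b<p))

    fromℕ-injective : ∀ {a b} → a < p → b < p → fromℕ a ≈ fromℕ b → a ≡ b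
    fromℕ-injective {a} {b} a<p b<p a≈b with ≤-total a b
    ... | inj₁ a≤b = fromℕ-≤-injective a≤b b<p a≈b
    ... | inj₂ b≤a = ≡.sym (fromℕ-≤-injective b≤a a<p (sym a≈b))

    p∤n! : ∀ {n} → n < p → ¬ p ∣ n !
    p∤n! {zero} _ = >⇒∤ 1<p
    p∤n! {suc n} n<p p∣ with euclidsLemma (suc n) (n !) p-prime p∣
    ... | inj₁ p∣n+1 = >⇒∤ n<p p∣n+1
    ... | inj₂ p∣n! = p∤n! (ℕ.<-trans (n<1+n n) n<p) p∣n!

    fromℕ[n!]≉0 : ∀ {n} → n < p → fromℕ (n !) ≉ 0#
    fromℕ[n!]≉0 {n} n<p = p∤n! n<p ∘ fromℕ≈0⇒p∣ (n !)

    fromℕ-square≉1 : ∀ {k} → 1 < k → suc k < p → fromℕ k * fromℕ k ≉ 1#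
    fromℕ-square≉1 {suc zero} (s<s ()) _
    fromℕ-square≉1 {suc m@(suc _)} _ k+1<p k²≈1 with euclidsLemma m (2 ℕ.+ m) p-prime (fromℕ≈0⇒p∣ _ m[m+2]≈0)
      where
      square-identity : ∀ m → suc (m ℕ.* (2 ℕ.+ m)) ≡ suc m ℕ.* suc m
      square-identity = solve-∀
      m[m+2]≈0 : fromℕ (m ℕ.* (2 ℕ.+ m)) ≈ 0#
      m[m+2]≈0 = +-identityʳ-unique 1# _ (begin
        fromℕ (suc (m ℕ.* (2 ℕ.+ m)))   ≡⟨ ≡.cong fromℕ (square-identity m) ⟩
        fromℕ (suc m ℕ.* suc m)         ≈⟨ fromℕ-homo-* (suc m) (suc m) ⟩
        fromℕ (suc m) * fromℕ (suc m)   ≈⟨ k²≈1 ⟩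
        1#                              ∎)
    ... | inj₁ p∣m = >⇒∤ (ℕ.<-trans (n<1+n m) (ℕ.<-trans (n<1+n (suc m)) k+1<p)) p∣m
    ... | inj₂ p∣m+2 = >⇒∤ k+1<p p∣m+2

    -- Wilson's theorem: the residues 2, …, p − 2 split into pairs {k, k⁻¹} with k ≠ k⁻¹.
    module _ {r : ℕ} (p≡3+r : p ≡ 3 ℕ.+ r) where
      open Products *-commutativeMonoid using (Paired; InjectiveOn; ∏-paired)

      middle : List ℕ
      middle = applyDownFrom (2 ℕ.+_) r

      fromℕ[2+r]≈-1 : fromℕ (2 ℕ.+ r) ≈ - 1#
      fromℕ[2+r]≈-1 = fromℕ-suc≈0 (2 ℕ.+ r) (≡.subst (λ n → fromℕ n ≈ 0#) p≡3+r char-p)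

      <r⇒2+<p : ∀ {i} → i < r → 2 ℕ.+ i < p
      <r⇒2+<p i<r = ≡.subst (_ <_) (≡.sym p≡3+r) (ℕ.m<n⇒m<1+n (s<s (s<s i<r)))

      ∈middle⇒<p : ∀ {k} → k ∈ middle → k < p
      ∈middle⇒<p k∈ with _ , i<r , ≡.refl ← ∈-applyDownFrom⁻ (2 ℕ.+_) k∈ = <r⇒2+<p i<r

      middle-unique : Unique middle
      middle-unique = applyDownFrom⁺₁ (2 ℕ.+_) r (λ j<i _ → ℕ.<⇒≢ j<i ∘ ≡.sym ∘ ℕ.+-cancelˡ-≡ 2 _ _)

      middle-injective : InjectiveOn fromℕ middle
      middle-injective k∈ l∈ = fromℕ-injective (∈middle⇒<p k∈) (∈middle⇒<p l∈)

      partner∈middle : ∀ {i j} → i < r → j < p → fromℕ (2 ℕ.+ i) * fromℕ j ≈ 1# → j ∈ middle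
      partner∈middle {i} {zero} _ _ e = contradiction (trans (sym e) (zeroʳ _)) 1≉0
      partner∈middle {i} {suc zero} i<r _ e =
        contradiction (fromℕ-injective {b = 1} (<r⇒2+<p i<r) (ℕ.<-trans (s<s z<s) (<r⇒2+<p i<r)) (begin
          fromℕ (2 ℕ.+ i)              ≈⟨ sym (*-identityʳ _) ⟩
          fromℕ (2 ℕ.+ i) * 1#         ≈⟨ *-congˡ (sym (+-identityʳ 1#)) ⟩
          fromℕ (2 ℕ.+ i) * fromℕ 1    ≈⟨ e ⟩
          1#                           ≈⟨ sym (+-identityʳ 1#) ⟩
          fromℕ 1                      ∎)) λ ()
      partner∈middle {i} {suc (suc i′)} i<r j<p e with ℕ.m≤n⇒m<n∨m≡n (ℕ.≤-pred (ℕ.≤-pred (ℕ.≤-pred (≡.subst (_ <_) p≡3+r j<p))))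
      ... | inj₁ i′<r = ∈-applyDownFrom⁺ (2 ℕ.+_) i′<r
      ... | inj₂ ≡.refl = contradiction (ℕ.+-cancelˡ-≡ 2 _ _ (fromℕ-injective (<r⇒2+<p i<r) 2+r<p k≈2+r)) (ℕ.<⇒≢ i<r)
        where
        2+r<p : 2 ℕ.+ r < p
        2+r<p = ≡.subst (_ <_) (≡.sym p≡3+r) (n<1+n _)
        k≈2+r : fromℕ (2 ℕ.+ i) ≈ fromℕ (2 ℕ.+ r)
        k≈2+r = trans (inverse-unique (trans (*-comm _ _) (trans (*-congˡ (sym fromℕ[2+r]≈-1)) e)) -1*-1≈1) (sym fromℕ[2+r]≈-1)

      middle-paired : Paired fromℕ middle
      middle-paired k∈ with i , i<r , ≡.refl ← ∈-applyDownFrom⁻ (2 ℕ.+_) k∈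
        with j , j<p , kj≈1 ← fromℕ-invertible z<s (<r⇒2+<p i<r)
        = j , partner∈middle i<r j<p kj≈1 , j≢k , kj≈1
        where
        j≢k : j ≢ 2 ℕ.+ i
        j≢k ≡.refl = fromℕ-square≉1 {2 ℕ.+ i} (s<s z<s) (≡.subst (3 ℕ.+ i <_) (≡.sym p≡3+r) (s<s (s<s (s<s i<r)))) kj≈1

      wilson-3+r : fromℕ ((2 ℕ.+ r) !) ≈ - 1#
      wilson-3+r = begin
        fromℕ ((2 ℕ.+ r) ℕ.* suc r !)            ≈⟨ fromℕ-homo-* (2 ℕ.+ r) (suc r !) ⟩
        fromℕ (2 ℕ.+ r) * fromℕ (suc r !)        ≈⟨ *-cong fromℕ[2+r]≈-1 (fromℕ[r+1]!≈∏ r) ⟩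
        - 1# * ∏ fromℕ middle                    ≈⟨ *-congˡ (∏-paired (length middle) ℕ.≤-refl middle-unique middle-injective middle-paired) ⟩
        - 1# * 1#                                ≈⟨ *-identityʳ _ ⟩
        - 1#                                     ∎

    wilson : p ≢ 2 → fromℕ (pred p !) ≈ - 1#
    wilson p≢2 = ≡.subst (λ n → fromℕ (pred n !) ≈ - 1#) (≡.sym p≡3+[p∸3]) (wilson-3+r p≡3+[p∸3])
      where
      p≡3+[p∸3] : p ≡ 3 ℕ.+ (p ℕ.∸ 3)
      p≡3+[p∸3] = ≡.sym (ℕ.m+[n∸m]≡n (ℕ.≤∧≢⇒< (1<p) (p≢2 ∘ ≡.sym)))

    module FactorialInverses (inv : Carrier → Carrier) (inv-right : ∀ x → x ≉ 0# → x * inv x ≈ 1#) where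

      fromℕ[n!]*inv : ∀ {n} → n < p → fromℕ (n !) * inv (fromℕ (n !)) ≈ 1#
      fromℕ[n!]*inv n<p = inv-right _ (fromℕ[n!]≉0 n<p)

      inv[0!]≈1 : inv (fromℕ (0 !)) ≈ 1#
      inv[0!]≈1 = inverse-unique (fromℕ[n!]*inv (ℕ.<-trans z<s 1<p)) (trans (*-identityʳ _) (+-identityʳ 1#))

      inv-fromℕ-!-step : ∀ {i} → suc i < p → inv (fromℕ (suc i !)) * fromℕ (suc i) ≈ inv (fromℕ (i !))
      inv-fromℕ-!-step {i} i+1<p = inverse-unique {fromℕ (i !)} (begin
        fromℕ (i !) * (inv (fromℕ (suc i !)) * fromℕ (suc i))   ≈⟨ x∙yz≈y∙xz _ _ _ ⟩
        inv (fromℕ (suc i !)) * (fromℕ (i !) * fromℕ (suc i))   ≈⟨ *-congˡ (trans (*-comm _ _) (sym (fromℕ-homo-* (suc i) (i !)))) ⟩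
        inv (fromℕ (suc i !)) * fromℕ (suc i !)                 ≈⟨ *-comm _ _ ⟩
        fromℕ (suc i !) * inv (fromℕ (suc i !))                 ≈⟨ fromℕ[n!]*inv i+1<p ⟩
        1#                                                      ∎) (fromℕ[n!]*inv (ℕ.<-trans (n<1+n i) i+1<p))

      inv[pred-p!]≈-1 : p ≢ 2 → inv (fromℕ (pred p !)) ≈ - 1#
      inv[pred-p!]≈-1 p≢2 = inverse-unique
        (trans (*-congʳ (sym (wilson p≢2))) (fromℕ[n!]*inv (ℕ.m≤pred[n]⇒suc[m]≤n ℕ.≤-refl)))
        -1*-1≈1

module TruncatedPolynomials {c ℓ : Level} (R : CommutativeRing c ℓ) where
  open CommutativeRing R
  open Base R
  open import Relation.Binary.Reasoning.Setoid setoid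
  open import Algebra.Properties.Ring ring using (-1*x≈-x)
  open import Algebra.Properties.CommutativeSemigroup +-commutativeSemigroup using (interchange)
  open import Algebra.Properties.CommutativeSemigroup *-commutativeSemigroup using (x∙yz≈y∙xz)

  sumBelow-cong : ∀ {g h} n → (∀ i → i < n → g i ≈ h i) → sumBelow g n ≈ sumBelow h n
  sumBelow-cong zero _ = refl
  sumBelow-cong (suc n) g≈h = +-cong (sumBelow-cong n (λ i i<n → g≈h i (ℕ.m<n⇒m<1+n i<n))) (g≈h n (n<1+n n))

  sumBelow-zero : ∀ {h} n → (∀ i → i < n → h i ≈ 0#) → sumBelow h n ≈ 0#
  sumBelow-zero zero _ = refl
  sumBelow-zero (suc n) h≈0 =
    trans (+-cong (sumBelow-zero n (λ i i<n → h≈0 i (ℕ.m<n⇒m<1+n i<n))) (h≈0 n (n<1+n n))) (+-identityʳ 0#)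

  sumBelow-single : ∀ {h} n {k} → k < n → (∀ i → i < n → i ≢ k → h i ≈ 0#) → sumBelow h n ≈ h k
  sumBelow-single (suc n) {k} k<n+1 h≈0 with ℕ.m<1+n⇒m<n∨m≡n k<n+1
  ... | inj₁ k<n = trans (+-cong (sumBelow-single n k<n (λ i i<n → h≈0 i (ℕ.m<n⇒m<1+n i<n)))
                                 (h≈0 n (n<1+n n) (ℕ.<⇒≢ k<n ∘ ≡.sym))) (+-identityʳ _)
  ... | inj₂ ≡.refl = trans (+-congʳ (sumBelow-zero n (λ i i<n → h≈0 i (ℕ.m<n⇒m<1+n i<n) (ℕ.<⇒≢ i<n))))
                            (+-identityˡ _)

  sumBelow-+ : ∀ g h n → sumBelow (λ i → g i + h i) n ≈ sumBelow g n + sumBelow h n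
  sumBelow-+ g h zero = sym (+-identityˡ 0#)
  sumBelow-+ g h (suc n) = trans (+-congʳ (sumBelow-+ g h n)) (interchange _ _ _ _)

  *-sumBelow : ∀ a h n → a * sumBelow h n ≈ sumBelow (λ i → a * h i) n
  *-sumBelow a h zero = zeroʳ a
  *-sumBelow a h (suc n) = trans (distribˡ a _ _) (+-congʳ (*-sumBelow a h n))

  infix 4 _≐_
  _≐_ : Λ → Λ → Set ℓ
  f ≐ g = ∀ n → f n ≈ g n

  ≐⇒≈Λ : ∀ {p f g} → f ≐ g → Trunc._≈Λ_ p f g
  ≐⇒≈Λ f≐g n _ = f≐g n

  infixr 7 _•_
  _•_ : Carrier → Λ → Λ
  (a • f) n = a * f n

  *Λ-congˡ : ∀ f {g h} → g ≐ h → f *Λ g ≐ f *Λ h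
  *Λ-congˡ f g≐h n = sumBelow-cong (suc n) (λ i _ → *-congˡ (g≐h (n ∸ i)))

  *Λ-distribˡ-+Λ : ∀ f g h → f *Λ (g +Λ h) ≐ f *Λ g +Λ f *Λ h
  *Λ-distribˡ-+Λ f g h n = trans (sumBelow-cong (suc n) (λ i _ → distribˡ _ _ _)) (sumBelow-+ _ _ (suc n))

  *Λ-•ʳ : ∀ f a g → f *Λ (a • g) ≐ a • (f *Λ g)
  *Λ-•ʳ f a g n = trans (sumBelow-cong (suc n) (λ i _ → x∙yz≈y∙xz _ _ _)) (sym (*-sumBelow a _ (suc n)))

  constΛ-*Λ : ∀ a f → constΛ a *Λ f ≐ a • f
  constΛ-*Λ a f n = sumBelow-single (suc n) z<s λ where
    zero _ 0≢0 → contradiction ≡.refl 0≢0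
    (suc i) _ _ → zeroˡ _

  VanishesBelow : ℕ → Λ → Set ℓ
  VanishesBelow k f = ∀ n → n < k → f n ≈ 0#

  *Λ-vanishes : ∀ {a b f g} → VanishesBelow a f → VanishesBelow b g → VanishesBelow (a ℕ.+ b) (f *Λ g)
  *Λ-vanishes {a} {b} {f} {g} f≈0 g≈0 n n<a+b = sumBelow-zero (suc n) term≈0
    where
    term≈0 : ∀ i → i < suc n → f i * g (n ∸ i) ≈ 0#
    term≈0 i i<n+1 with i ℕ.<? a
    ... | yes i<a = trans (*-congʳ (f≈0 i i<a)) (zeroˡ _)
    ... | no i≮a = trans (*-congˡ (g≈0 (n ∸ i) n∸i<b)) (zeroʳ _)
      where
      n∸i<b : n ∸ i < b
      n∸i<b = ℕ.<-≤-trans (ℕ.∸-monoˡ-< n<a+b (ℕ.≤-pred i<n+1))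
                (≤-trans (ℕ.∸-monoʳ-≤ (a ℕ.+ b) (ℕ.≮⇒≥ i≮a)) (≤-reflexive (ℕ.m+n∸m≡n a b)))

  *Λ-leading : ∀ {a b f g} → VanishesBelow a f → VanishesBelow b g → (f *Λ g) (a ℕ.+ b) ≈ f a * g b
  *Λ-leading {a} {b} {f} {g} f≈0 g≈0 = trans (sumBelow-single (suc (a ℕ.+ b)) (s<s (ℕ.m≤m+n a b)) term≈0)
                                             (*-congˡ (reflexive (≡.cong g (ℕ.m+n∸m≡n a b))))
    where
    term≈0 : ∀ i → i < suc (a ℕ.+ b) → i ≢ a → f i * g (a ℕ.+ b ∸ i) ≈ 0#
    term≈0 i i<a+b+1 i≢a with ℕ.<-cmp i a
    ... | tri< i<a _ _ = trans (*-congʳ (f≈0 i i<a)) (zeroˡ _)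
    ... | tri≈ _ i≡a _ = contradiction i≡a i≢a
    ... | tri> _ _ a<i = trans (*-congˡ (g≈0 _ a+b∸i<b)) (zeroʳ _)
      where
      a+b∸i<b : a ℕ.+ b ∸ i < b
      a+b∸i<b = ℕ.<-≤-trans (ℕ.∸-monoʳ-< a<i (ℕ.≤-pred i<a+b+1)) (≤-reflexive (ℕ.m+n∸m≡n a b))

  powΛ-vanishes : ∀ {f} → VanishesBelow 1 f → ∀ n → VanishesBelow n (powΛ f n)
  powΛ-vanishes f≈0 zero _ ()
  powΛ-vanishes f≈0 (suc n) = *Λ-vanishes f≈0 (powΛ-vanishes f≈0 n)

  powΛ-leading : ∀ {f} → VanishesBelow 1 f → ∀ n → powΛ f n n ≈ powK (f 1) n
  powΛ-leading f≈0 zero = refl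
  powΛ-leading f≈0 (suc n) = trans (*Λ-leading f≈0 (powΛ-vanishes f≈0 n)) (*-congˡ (powΛ-leading f≈0 n))

  powK-1# : ∀ n → powK 1# n ≈ 1#
  powK-1# zero = refl
  powK-1# (suc n) = trans (*-identityˡ _) (powK-1# n)

  +Λ-identityˡ : ∀ f → zeroΛ +Λ f ≐ f
  +Λ-identityˡ f zero = +-identityˡ _
  +Λ-identityˡ f (suc n) = +-identityˡ _

  fromℕ1-• : ∀ f → fromℕ 1 • f ≐ f
  fromℕ1-• f n = trans (*-congʳ (+-identityʳ 1#)) (*-identityˡ _)

  *Λ-•ʳ-+Λ : ∀ f a g → f *Λ (a • g) +Λ f *Λ g ≐ (1# + a) • (f *Λ g)
  *Λ-•ʳ-+Λ f a g n = begin
    (f *Λ (a • g)) n + (f *Λ g) n        ≈⟨ +-congʳ (*Λ-•ʳ f a g n) ⟩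
    a * (f *Λ g) n + (f *Λ g) n          ≈⟨ +-comm _ _ ⟩
    (f *Λ g) n + a * (f *Λ g) n          ≈⟨ +-congʳ (sym (*-identityˡ _)) ⟩
    1# * (f *Λ g) n + a * (f *Λ g) n     ≈⟨ sym (distribʳ _ 1# a) ⟩
    (1# + a) * (f *Λ g) n                ∎

  constΛ-*Λ-• : ∀ {a b c} g → a * b ≈ c → constΛ a *Λ (b • g) ≐ constΛ c *Λ g
  constΛ-*Λ-• {a} {b} {c} g ab≈c n = begin
    (constΛ a *Λ (b • g)) n   ≈⟨ constΛ-*Λ a (b • g) n ⟩
    a * (b * g n)             ≈⟨ sym (*-assoc a b _) ⟩
    (a * b) * g n             ≈⟨ *-congʳ ab≈c ⟩
    c * g n                   ≈⟨ sym (constΛ-*Λ c g n) ⟩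
    (constΛ c *Λ g) n         ∎

  leading-≈Λ : ∀ {q g h} → VanishesBelow q g → VanishesBelow q h → g q ≈ h q → Trunc._≈Λ_ (suc q) g h
  leading-≈Λ g≈0 h≈0 gq≈hq n n<q+1 with ℕ.m<1+n⇒m<n∨m≡n n<q+1
  ... | inj₁ n<q = trans (g≈0 n n<q) (sym (h≈0 n n<q))
  ... | inj₂ ≡.refl = gq≈hq

  module _ (inv : Carrier → Carrier) where

    E0-at-0 : ∀ {f} → VanishesBelow 1 f → ∀ n → E0 inv (suc n) f 0 ≈ inv (fromℕ (0 !))
    E0-at-0 _ zero = trans (+-identityˡ _) (trans (constΛ-*Λ _ oneΛ 0) (*-identityʳ _))
    E0-at-0 {f} f≈0 (suc n) = trans (+-cong (E0-at-0 f≈0 n) last-term≈0) (+-identityʳ _)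
      where
      last-term≈0 : (constΛ (inv (fromℕ (suc n !))) *Λ powΛ f (suc n)) 0 ≈ 0#
      last-term≈0 = trans (constΛ-*Λ _ (powΛ f (suc n)) 0) (trans (*-congˡ (powΛ-vanishes f≈0 (suc n) 0 z<s)) (zeroʳ _))

    E0-pred : ∀ {q} f → inv (fromℕ (q !)) ≈ - 1# → E0 inv q f ≐ E0 inv (suc q) f +Λ powΛ f q
    E0-pred {q} f c≈-1 n = begin
      E0 inv q f n                                  ≈⟨ sym (+-identityʳ _) ⟩
      E0 inv q f n + 0#                             ≈⟨ +-congˡ (sym (-‿inverseˡ (powΛ f q n))) ⟩
      E0 inv q f n + (- powΛ f q n + powΛ f q n)    ≈⟨ sym (+-assoc _ _ _) ⟩
      (E0 inv q f n + - powΛ f q n) + powΛ f q n    ≈⟨ +-congʳ (+-congˡ -fq≈last-term) ⟩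
      E0 inv (suc q) f n + powΛ f q n               ∎
      where
      -fq≈last-term : - powΛ f q n ≈ (constΛ (inv (fromℕ (q !))) *Λ powΛ f q) n
      -fq≈last-term = begin
        - powΛ f q n                             ≈⟨ sym (-1*x≈-x _) ⟩
        - 1# * powΛ f q n                        ≈⟨ *-congʳ (sym c≈-1) ⟩
        inv (fromℕ (q !)) * powΛ f q n           ≈⟨ sym (constΛ-*Λ _ (powΛ f q) n) ⟩
        (constΛ (inv (fromℕ (q !))) *Λ powΛ f q) n ∎

    E0-pred-*Λ-inverse : ∀ {q f u} → VanishesBelow 1 f → inv (fromℕ (0 !)) ≈ 1# → inv (fromℕ (q !)) ≈ - 1# →
                         Trunc._≈Λ_ (suc q) (u *Λ E0 inv (suc q) f) oneΛ →
                         Trunc._≈Λ_ (suc q) (u *Λ E0 inv q f) (oneΛ +Λ constΛ (powK (f 1) q) *Λ powΛ yΛ q)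
    E0-pred-*Λ-inverse {q} {f} {u} f≈0 c₀≈1 c≈-1 uE≈1 n n<q+1 = begin
      (u *Λ E0 inv q f) n                                          ≈⟨ *Λ-congˡ u {E0 inv q f} (E0-pred {q} f c≈-1) n ⟩
      (u *Λ (E0 inv (suc q) f +Λ powΛ f q)) n                      ≈⟨ *Λ-distribˡ-+Λ u (E0 inv (suc q) f) (powΛ f q) n ⟩
      (u *Λ E0 inv (suc q) f) n + (u *Λ powΛ f q) n                ≈⟨ +-cong (uE≈1 n n<q+1) (ufq≈ayq n n<q+1) ⟩
      oneΛ n + (constΛ (powK (f 1) q) *Λ powΛ yΛ q) n              ∎
      where
      y≈0 : VanishesBelow 1 yΛ
      y≈0 zero _ = refl
      y≈0 (suc _) (s<s ())
      u₀≈1 : u 0 ≈ 1#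
      u₀≈1 = begin
        u 0                               ≈⟨ sym (*-identityʳ _) ⟩
        u 0 * 1#                          ≈⟨ *-congˡ (sym (trans (E0-at-0 f≈0 q) c₀≈1)) ⟩
        u 0 * E0 inv (suc q) f 0          ≈⟨ sym (+-identityˡ _) ⟩
        (u *Λ E0 inv (suc q) f) 0         ≈⟨ uE≈1 0 z<s ⟩
        1#                                ∎
      ufq≈ayq : Trunc._≈Λ_ (suc q) (u *Λ powΛ f q) (constΛ (powK (f 1) q) *Λ powΛ yΛ q)
      ufq≈ayq = leading-≈Λ (*Λ-vanishes {0} (λ _ ()) (powΛ-vanishes f≈0 q))
                           (*Λ-vanishes {0} (λ _ ()) (powΛ-vanishes y≈0 q)) (begin
        (u *Λ powΛ f q) q                          ≈⟨ *Λ-leading {0} (λ _ ()) (powΛ-vanishes f≈0 q) ⟩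
        u 0 * powΛ f q q                           ≈⟨ *-cong u₀≈1 (powΛ-leading f≈0 q) ⟩
        1# * powK (f 1) q                          ≈⟨ *-comm _ _ ⟩
        powK (f 1) q * 1#                          ≈⟨ *-congˡ (sym (trans (powΛ-leading y≈0 q) (powK-1# q))) ⟩
        powK (f 1) q * powΛ yΛ q q                 ≈⟨ sym (*Λ-leading {0} (λ _ ()) (powΛ-vanishes y≈0 q)) ⟩
        (constΛ (powK (f 1) q) *Λ powΛ yΛ q) q     ∎)

module Derivations {c ℓ : Level} (R : CommutativeRing c ℓ) (p : ℕ)
                   {m ℓm : Level} {Mo : Base.Mod.ΛModule R p m ℓm} (D : Base.Mod.Derivation R p Mo) where
  module R = CommutativeRing R
  open R using (Carrier; _*_; _≈_; 0#; 1#)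
  open Base R
  open TruncatedPolynomials R
  open Mod p
  open ΛModule Mo
  open Derivation D
  open import Algebra.Properties.AbelianGroup abGroup using (identityʳ-unique)
  open import Relation.Binary.Reasoning.Setoid setoid

  ·-congˡ : ∀ f {x y} → x ≈M y → f · x ≈M f · y
  ·-congˡ f = ·-cong (λ _ _ → R.refl)

  ·-congʳ : ∀ {f g} x → f ≐ g → f · x ≈M g · x
  ·-congʳ x f≐g = ·-cong (≐⇒≈Λ f≐g) refl

  ·-zeroʳ : ∀ f → f · 0M ≈M 0M
  ·-zeroʳ f = identityʳ-unique (f · 0M) (f · 0M) (sym (trans (·-congˡ f (sym (identityʳ 0M))) (·-distribˡ f 0M 0M)))

  zeroΛ-· : ∀ x → zeroΛ · x ≈M 0M
  zeroΛ-· x = identityʳ-unique (zeroΛ · x) (zeroΛ · x)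
    (sym (trans (·-congʳ x (λ n → R.sym (+Λ-identityˡ zeroΛ n))) (·-distribʳ zeroΛ zeroΛ x)))

  d-constΛ-*Λ : ∀ a f → d (constΛ a *Λ f) ≈M constΛ a · d f
  d-constΛ-*Λ a f = begin
    d (constΛ a *Λ f)                          ≈⟨ leibniz (constΛ a) f ⟩
    (constΛ a · d f) +M (f · d (constΛ a))     ≈⟨ ∙-congˡ (trans (·-congˡ f (d-const a)) (·-zeroʳ f)) ⟩
    (constΛ a · d f) +M 0M                     ≈⟨ identityʳ _ ⟩
    constΛ a · d f                             ∎

  d-powΛ : ∀ f n → d (powΛ f (suc n)) ≈M (fromℕ (suc n) • powΛ f n) · d f
  d-powΛ f zero = begin
    d (f *Λ oneΛ)                           ≈⟨ leibniz f oneΛ ⟩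
    (f · d oneΛ) +M (oneΛ · d f)            ≈⟨ ∙-cong (trans (·-congˡ f (d-const 1#)) (·-zeroʳ f)) (·-identity (d f)) ⟩
    0M +M d f                               ≈⟨ identityˡ (d f) ⟩
    d f                                     ≈⟨ sym (trans (·-congʳ (d f) (fromℕ1-• oneΛ)) (·-identity (d f))) ⟩
    (fromℕ 1 • oneΛ) · d f                  ∎
  d-powΛ f (suc n) = begin
    d (f *Λ fⁿ⁺¹)                                          ≈⟨ leibniz f fⁿ⁺¹ ⟩
    (f · d fⁿ⁺¹) +M (fⁿ⁺¹ · d f)                           ≈⟨ ∙-congʳ (·-congˡ f (d-powΛ f n)) ⟩
    (f · ((fromℕ (suc n) • fⁿ) · d f)) +M (fⁿ⁺¹ · d f)     ≈⟨ ∙-congʳ (sym (·-assoc f _ (d f))) ⟩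
    ((f *Λ (fromℕ (suc n) • fⁿ)) · d f) +M (fⁿ⁺¹ · d f)    ≈⟨ sym (·-distribʳ _ fⁿ⁺¹ (d f)) ⟩
    (f *Λ (fromℕ (suc n) • fⁿ) +Λ fⁿ⁺¹) · d f              ≈⟨ ·-congʳ (d f) (*Λ-•ʳ-+Λ f (fromℕ (suc n)) fⁿ) ⟩
    (fromℕ (suc (suc n)) • fⁿ⁺¹) · d f                     ∎
    where
    fⁿ = powΛ f n
    fⁿ⁺¹ = powΛ f (suc n)

  module _ (inv : Carrier → Carrier) (f : Λ) where

    private
      term : ℕ → Λ
      term i = constΛ (inv (fromℕ (i !))) *Λ powΛ f i

    d-E0 : ∀ n → (∀ i → i < n → inv (fromℕ (suc i !)) * fromℕ (suc i) ≈ inv (fromℕ (i !))) →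
           d (E0 inv (suc n) f) ≈M E0 inv n f · d f
    d-E0 zero _ = begin
      d (zeroΛ +Λ term 0)          ≈⟨ d-+ zeroΛ (term 0) ⟩
      d zeroΛ +M d (term 0)        ≈⟨ ∙-cong (d-const 0#) (trans (d-constΛ-*Λ _ oneΛ) (trans (·-congˡ _ (d-const 1#)) (·-zeroʳ _))) ⟩
      0M +M 0M                     ≈⟨ identityˡ 0M ⟩
      0M                           ≈⟨ sym (zeroΛ-· (d f)) ⟩
      zeroΛ · d f                  ∎
    d-E0 (suc n) step = begin
      d (E0 inv (suc n) f +Λ term (suc n))              ≈⟨ d-+ _ (term (suc n)) ⟩
      d (E0 inv (suc n) f) +M d (term (suc n))          ≈⟨ ∙-cong (d-E0 n (λ i i<n → step i (ℕ.m<n⇒m<1+n i<n))) d-last-term ⟩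
      (E0 inv n f · d f) +M (term n · d f)              ≈⟨ sym (·-distribʳ _ (term n) (d f)) ⟩
      E0 inv (suc n) f · d f                            ∎
      where
      d-last-term : d (term (suc n)) ≈M term n · d f
      d-last-term = begin
        d (term (suc n))                                                         ≈⟨ d-constΛ-*Λ _ (powΛ f (suc n)) ⟩
        constΛ (inv (fromℕ (suc n !))) · d (powΛ f (suc n))                       ≈⟨ ·-congˡ _ (d-powΛ f n) ⟩
        constΛ (inv (fromℕ (suc n !))) · ((fromℕ (suc n) • powΛ f n) · d f)       ≈⟨ sym (·-assoc _ _ (d f)) ⟩
        (constΛ (inv (fromℕ (suc n !))) *Λ (fromℕ (suc n) • powΛ f n)) · d f      ≈⟨ ·-congʳ (d f) (constΛ-*Λ-• (powΛ f n) (step n (n<1+n n))) ⟩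
        term n · d f                                                             ∎

lemma3p1 : ∀ {c ℓ : Level} (p : ℕ) → Prime p → ¬ (p ≡ 2) →
           (R : CommutativeRing c ℓ) →
           let open CommutativeRing R
               open Base R
               open Trunc p
               open Mod p
           in (K : IsAlgClosureOfFp p) →
              ∀ {m ℓm : Level} (Mo : ΛModule m ℓm) (D : Derivation Mo) →
              let open ΛModule Mo
                  open Derivation D
                  open IsAlgClosureOfFp K
              in ∀ (f : Λ) → f 0 ≈ 0# →
                 ∀ (u : Λ) → (u *Λ E0 inv p f) ≈Λ oneΛ →
                 (u · d (E0 inv p f))
                   ≈M ((oneΛ +Λ constΛ (powK (f 1) (p ∸ 1)) *Λ powΛ yΛ (p ∸ 1)) · d f)
lemma3p1 zero p-prime _ _ _ _ _ _ _ _ _ = ⊥-elim (¬prime[0] p-prime)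
lemma3p1 (suc q) p-prime p≢2 R K Mo D f f₀≈0 u uE≈1 = begin
  u · d (E0 inv (suc q) f)      ≈⟨ ·-congˡ u (d-E0 inv f q (λ _ i<q → inv-fromℕ-!-step (s<s i<q))) ⟩
  u · (E0 inv q f · d f)        ≈⟨ sym (·-assoc u (E0 inv q f) (d f)) ⟩
  (u *Λ E0 inv q f) · d f       ≈⟨ ·-cong (E0-pred-*Λ-inverse inv f≈0 inv[0!]≈1 (inv[pred-p!]≈-1 p≢2) uE≈1) refl ⟩
  (oneΛ +Λ constΛ (powK (f 1) q) *Λ powΛ yΛ q) · d f ∎
  where
  open Base R
  open IsAlgClosureOfFp K
  open RingFacts.PrimeCharacteristic R p-prime 1≉0 char-p using (module FactorialInverses)
  open FactorialInverses inv inv-right using (inv[0!]≈1; inv-fromℕ-!-step; inv[pred-p!]≈-1)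
  open TruncatedPolynomials R using (VanishesBelow; E0-pred-*Λ-inverse)
  open Derivations R (suc q) D using (·-congˡ; d-E0)
  open Mod.ΛModule Mo
  open Mod.Derivation D
  open import Relation.Binary.Reasoning.Setoid setoid
  f≈0 : VanishesBelow 1 f
  f≈0 zero _ = f₀≈0
  f≈0 (suc _) (s<s ())
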